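{- Let $k\ge2$ be an integer and $\ell$ an integer with $0\le \ell\le k-1$. Let $M$ be an $n\times n$ integer matrix with $M^T=-M$ and $MM^T=mI_n$, where $m$ is an integer with $m+\ell^2\equiv -1\pmod k$. Let $C_{2n,k}(M)$ be the $\mathbb{Z}_k$-code of length $2n$ with generator matrix $(I_n\mid M+\ell I_n)$, entries read modulo $k$. Then $C_{2n,k}(M)$ is self-dual, and for any integers $a,b,c,d$ with $b\equiv c-\ell d\pmod k$ and $d\equiv a+\ell b\pmod k$, the $2n$ rows of $$F(M)=\frac{1}{\sqrt k}\begin{pmatrix} aI_n+bM & cI_n+dM\\ -cI_n+dM & aI_n-bM\end{pmatrix}$$ form a $\frac1k(a^2+mb^2+c^2+md^2)$-frame in the unimodular lattice $A_k(C_{2n,k}(M))$.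
   Context: $\mathbb{Z}_k$ is the ring of integers mod $k$, identified with $\{0,1,\dots,k-1\}\subset\mathbb{Z}$; a $\mathbb{Z}_k$-code of length $N$ is a submodule of $\mathbb{Z}_k^N$, self-dual if $C=C^\perp$ under the standard inner product. Construction A: $A_k(C)=\frac{1}{\sqrt k}\{c+k\mathbb{Z}^N : c\in C\}$, a unimodular lattice when $C$ is self-dual. For a positive integer $r$, an $r$-frame of a unimodular lattice $L$ of dimension $N$ is a set $\{f_1,\dots,f_N\}\subset L$ with $(f_i,f_j)=r\delta_{i,j}$. -}

module Defs where

open import Data.Nat using (ℕ; zero; suc)
open import Data.Integer using (ℤ; +_; _+_; _*_; -_; _-_)
open import Data.Integer.Divisibility using (_∣_)
open import Data.Fin using (Fin; zero; suc; _≟_)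
open import Data.Vec.Functional using (Vector; _++_)
open import Data.Product using (Σ; _×_)
open import Relation.Nullary using (yes; no)
open import Relation.Binary.PropositionalEquality using (_≡_)

Vec : ℕ → Set
Vec N = Fin N → ℤ

Mat : ℕ → ℕ → Set
Mat p q = Fin p → Fin q → ℤ

Σᶠ : ∀ {N} → (Fin N → ℤ) → ℤ
Σᶠ {zero} f = + 0
Σᶠ {suc N} f = f zero + Σᶠ (λ i → f (suc i))

_·_ : ∀ {N} → Vec N → Vec N → ℤ
x · y = Σᶠ (λ i → x i * y i)

δ : ∀ {N} → Fin N → Fin N → ℤ
δ i j with i ≟ j
... | yes _ = + 1
... | no _ = + 0

_≡_[mod_] : ℤ → ℤ → ℕ → Set
a ≡ b [mod k ] = (+ k) ∣ (a - b)

-- A Z_k-code of length N is represented by its full preimage in ℤ^N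
-- (a predicate on integer vectors, invariant under reduction mod k).
Code : ℕ → Set₁
Code N = Vec N → Set

spanMod : ℕ → ∀ {p N} → Mat p N → Code N
spanMod k {p} {N} G v = Σ (Vec p) λ x → ∀ j → v j ≡ Σᶠ (λ i → x i * G i j) [mod k ]

dual : ℕ → ∀ {N} → Code N → Code N
dual k C v = ∀ w → C w → (v · w) ≡ + 0 [mod k ]

SelfDual : ℕ → ∀ {N} → Code N → Set
SelfDual k C = ∀ v → (C v → dual k C v) × (dual k C v → C v)

-- Construction A: A_k(C) = (1/√k){c + kℤ^N}. An element (1/√k)x is represented by
-- the integer vector x; membership: x lies in (the preimage of) C.
-- The inner product of (1/√k)x and (1/√k)y is (x · y)/k.
-- An r-frame of A_k(C): N vectors (1/√k) f_i with f_i ∈ C and (f_i,f_j) = r δ_ij,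
-- i.e. f_i · f_j = k r δ_ij.
IsFrameAk : (k : ℕ) → ∀ {N} → Code N → ℤ → (Fin N → Vec N) → Set
IsFrameAk k C r f = (∀ i → C (f i)) × (∀ i j → (f i · f j) ≡ (+ k) * r * δ i j)

I : ∀ {n} → Mat n n
I = δ

genMat : ∀ {n} → Mat n n → ℤ → Mat n (Data.Nat._+_ n n)
genMat M ℓ i = I i ++ (λ j → M i j + ℓ * I i j)

C2nk : ℕ → ∀ {n} → Mat n n → ℤ → Code (Data.Nat._+_ n n)
C2nk k M ℓ = spanMod k (genMat M ℓ)

-- the integer matrix √k · F(M) (rows of F(M) times √k)
Fmat : ∀ {n} → Mat n n → ℤ → ℤ → ℤ → ℤ → Mat (Data.Nat._+_ n n) (Data.Nat._+_ n n)
Fmat M a b c d =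
  (λ i → (λ j → a * I i j + b * M i j) ++ (λ j → c * I i j + d * M i j))
  ++ (λ i → (λ j → - (c * I i j) + d * M i j) ++ (λ j → a * I i j - b * M i j))

module Submission where

open import Defs
open import Data.Nat using (ℕ; _≤_; _<_)
open import Data.Integer using (ℤ; +_; _+_; _*_; -_; _-_)
open import Data.Fin using (Fin)
open import Data.Product using (Σ; _×_)
open import Relation.Binary.PropositionalEquality using (_≡_)

import Data.Nat as ℕ
open import Data.Nat using (zero; suc)
open import Data.Integer.Properties
  using (+-*-semiring; +-identityˡ; +-identityʳ; +-assoc; +-inverseʳ;
         *-comm; *-identityˡ; *-zeroˡ; *-zeroʳ;
         neg-distrib-+; neg-distribˡ-*; neg-distribʳ-*; neg-involutive; -1*i≡-i)
open import Data.Integer.Divisibility.Signed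
  using (_∣_; divides; ∣ᵤ⇒∣; ∣⇒∣ᵤ; ∣m∣n⇒∣m+n; ∣m∣n⇒∣m-n; ∣m⇒∣-m; ∣m⇒∣m*n; ∣n⇒∣m*n)
open import Data.Integer.Tactic.RingSolver using (solve-∀)
open import Data.Fin using (zero; suc; _↑ˡ_; _↑ʳ_; splitAt; _≟_)
open import Data.Fin.Properties
  using (suc-injective; ↑ˡ-injective; ↑ʳ-injective; splitAt-↑ˡ; splitAt-↑ʳ; join-splitAt)
open import Data.Product using (_,_)
open import Data.Sum using (inj₁; inj₂)
open import Data.Vec.Functional using (_++_)
open import Data.Vec.Functional.Properties using (lookup-++ˡ; lookup-++ʳ; ++-cong)
open import Function using (_∘_; Injective)
open import Level using (0ℓ)
open import Relation.Binary.Bundles using (Setoid)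
open import Relation.Binary.PropositionalEquality
  using (_≢_; _≗_; refl; sym; trans; cong; cong₂; cong-app; subst; module ≡-Reasoning)
import Relation.Binary.Reasoning.Setoid as SetoidReasoning
open import Relation.Nullary using (yes; no; contradiction)
open import Algebra.Properties.Semiring.Sum +-*-semiring using (sum; ∑-comm; *-distribˡ-sum)

-- Put N = M + ℓI. Antisymmetry and MMᵀ = mI give NNᵀ = NᵀN = (m + ℓ²)I ≡ -I (mod k).
-- For a generator matrix (I | N), the first identity makes the rows pairwise orthogonal mod k;
-- the second shows that a vector (x | y) orthogonal to all rows has x ≡ -yNᵀ, hence
-- xN ≡ -yNᵀN ≡ y, so it is the combination x(I | N): the code is self-dual.
-- Every row of √k·F(M) has the shape ((αI + βM)ᵢ | (γI + εM)ᵢ), and since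
-- (αI + βM)N = (αℓ - βm)I + (α + ℓβ)M such a row lies in the code once γ ≡ αℓ - βm and
-- ε ≡ α + ℓβ; the hypotheses on a, b, c, d give this for both halves of F(M).
-- Finally (αI + βM)(γI + εM)ᵀ = (αγ + βεm)I + (βγ - αε)M, which makes the Gram matrix of
-- √k·F(M) equal to (a² + mb² + c² + md²)I, and that number is divisible by k.

private
  variable
    n p q s N : ℕ

Σᶠ≡sum : (f : Fin N → ℤ) → Σᶠ f ≡ sum f
Σᶠ≡sum {zero} f = refl
Σᶠ≡sum {suc N} f = cong (_+_ (f zero)) (Σᶠ≡sum (f ∘ suc))

Σᶠ-cong : {f g : Fin N → ℤ} → f ≗ g → Σᶠ f ≡ Σᶠ g
Σᶠ-cong {zero} f≗g = refl
Σᶠ-cong {suc N} f≗g = cong₂ _+_ (f≗g zero) (Σᶠ-cong (f≗g ∘ suc))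

*-distribˡ-Σᶠ : (c : ℤ) (f : Fin N → ℤ) → c * Σᶠ f ≡ Σᶠ (λ i → c * f i)
*-distribˡ-Σᶠ {N} c f = begin
  c * Σᶠ f                 ≡⟨ cong (c *_) (Σᶠ≡sum f) ⟩
  c * sum f                ≡⟨ *-distribˡ-sum c f ⟩
  sum {N} (λ i → c * f i)  ≡⟨ Σᶠ≡sum (λ i → c * f i) ⟨
  Σᶠ (λ i → c * f i)       ∎
  where open ≡-Reasoning

Σᶠ-comm : (f : Fin p → Fin q → ℤ) → Σᶠ (λ i → Σᶠ (f i)) ≡ Σᶠ (λ j → Σᶠ (λ i → f i j))
Σᶠ-comm {p} {q} f = begin
  Σᶠ (λ i → Σᶠ (f i))                    ≡⟨ Σᶠ-cong (Σᶠ≡sum ∘ f) ⟩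
  Σᶠ (λ i → sum (f i))                   ≡⟨ Σᶠ≡sum (λ i → sum (f i)) ⟩
  sum {p} (λ i → sum (f i))              ≡⟨ ∑-comm f ⟩
  sum {q} (λ j → sum {p} (λ i → f i j))  ≡⟨ Σᶠ≡sum (λ j → sum {p} (λ i → f i j)) ⟨
  Σᶠ (λ j → sum {p} (λ i → f i j))       ≡⟨ Σᶠ-cong (λ j → Σᶠ≡sum (λ i → f i j)) ⟨
  Σᶠ (λ j → Σᶠ (λ i → f i j))            ∎
  where open ≡-Reasoning

Σᶠ-zero : Σᶠ {N} (λ _ → + 0) ≡ + 0
Σᶠ-zero {zero} = refl
Σᶠ-zero {suc N} = trans (+-identityˡ (Σᶠ {N} (λ _ → + 0))) (Σᶠ-zero {N})

Σᶠ-neg : (f : Fin N → ℤ) → Σᶠ (λ i → - f i) ≡ - Σᶠ f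
Σᶠ-neg {zero} f = refl
Σᶠ-neg {suc N} f =
  trans (cong (_+_ (- f zero)) (Σᶠ-neg (f ∘ suc))) (sym (neg-distrib-+ (f zero) (Σᶠ (f ∘ suc))))

Σᶠ-↑ : ∀ p {q} (f : Fin (p ℕ.+ q) → ℤ) → Σᶠ f ≡ Σᶠ (f ∘ (_↑ˡ q)) + Σᶠ (f ∘ (p ↑ʳ_))
Σᶠ-↑ zero f = sym (+-identityˡ _)
Σᶠ-↑ (suc p) f = trans (cong (_+_ (f zero)) (Σᶠ-↑ p (f ∘ suc))) (sym (+-assoc (f zero) _ _))

splitAt-elim : ∀ p {q} (P : Fin (p ℕ.+ q) → Set) →
  (∀ i → P (i ↑ˡ q)) → (∀ j → P (p ↑ʳ j)) → ∀ x → P x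
splitAt-elim p {q} P left right x with splitAt p x | join-splitAt p q x
... | inj₁ i | i↑ˡq≡x = subst P i↑ˡq≡x (left i)
... | inj₂ j | p↑ʳj≡x = subst P p↑ʳj≡x (right j)

↑ˡ≢↑ʳ : (i : Fin p) (j : Fin q) → i ↑ˡ q ≢ p ↑ʳ j
↑ˡ≢↑ʳ {p} {q} i j eq with trans (sym (splitAt-↑ˡ p i q)) (trans (cong (splitAt p) eq) (splitAt-↑ʳ p q j))
... | ()

δ-sym : (i j : Fin N) → δ i j ≡ δ j i
δ-sym i j with i ≟ j | j ≟ i
... | yes _   | yes _   = refl
... | yes i≡j | no j≢i  = contradiction (sym i≡j) j≢i
... | no i≢j  | yes j≡i = contradiction (sym j≡i) i≢j
... | no _    | no _    = refl

δ-≢ : {i j : Fin N} → i ≢ j → δ i j ≡ + 0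
δ-≢ {i = i} {j} i≢j with i ≟ j
... | yes i≡j = contradiction i≡j i≢j
... | no _    = refl

δ-injective : (f : Fin p → Fin q) → Injective _≡_ _≡_ f → (i j : Fin p) → δ (f i) (f j) ≡ δ i j
δ-injective f f-inj i j with i ≟ j | f i ≟ f j
... | yes _   | yes _     = refl
... | yes i≡j | no fi≢fj  = contradiction (cong f i≡j) fi≢fj
... | no i≢j  | yes fi≡fj = contradiction (f-inj fi≡fj) i≢j
... | no _    | no _      = refl

Σᶠ-δ : (i : Fin N) (g : Fin N → ℤ) → Σᶠ (λ j → δ i j * g j) ≡ g i
Σᶠ-δ {suc N} zero g = begin
  + 1 * g zero + Σᶠ (λ j → + 0 * g (suc j))
    ≡⟨ cong₂ _+_ (*-identityˡ (g zero)) (Σᶠ-cong (λ j → *-zeroˡ (g (suc j)))) ⟩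
  g zero + Σᶠ {N} (λ _ → + 0)  ≡⟨ cong (_+_ (g zero)) (Σᶠ-zero {N}) ⟩
  g zero + + 0                 ≡⟨ +-identityʳ (g zero) ⟩
  g zero                       ∎
  where open ≡-Reasoning
Σᶠ-δ {suc N} (suc i) g = begin
  + 0 * g zero + Σᶠ (λ j → δ (suc i) (suc j) * g (suc j))
    ≡⟨ cong₂ _+_ (*-zeroˡ (g zero)) (Σᶠ-cong (λ j → cong (_* g (suc j)) (δ-injective suc suc-injective i j))) ⟩
  + 0 + Σᶠ (λ j → δ i j * g (suc j))  ≡⟨ +-identityˡ _ ⟩
  Σᶠ (λ j → δ i j * g (suc j))        ≡⟨ Σᶠ-δ i (g ∘ suc) ⟩
  g (suc i)                           ∎
  where open ≡-Reasoning

infix 10 _ᵀ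
infixl 7 _*ᵥ_ _*ₘ_

_ᵀ : Mat p q → Mat q p
(A ᵀ) i j = A j i

_*ᵥ_ : Vec p → Mat p q → Vec q
(x *ᵥ A) j = Σᶠ (λ i → x i * A i j)

_*ₘ_ : Mat p q → Mat q s → Mat p s
(A *ₘ B) i j = Σᶠ (λ t → A i t * B t j)

aI+bA : ℤ → ℤ → Mat N N → Mat N N
aI+bA a b A i j = a * I i j + b * A i j

·-cong : {u u' w w' : Vec N} → u ≗ u' → w ≗ w' → u · w ≡ u' · w'
·-cong u≗u' w≗w' = Σᶠ-cong (λ j → cong₂ _*_ (u≗u' j) (w≗w' j))

·-congʳ : (u : Vec N) {w w' : Vec N} → w ≗ w' → u · w ≡ u · w'
·-congʳ u w≗w' = ·-cong {u = u} (λ _ → refl) w≗w'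

·-comm : (u w : Vec N) → u · w ≡ w · u
·-comm u w = Σᶠ-cong (λ j → *-comm (u j) (w j))

·-zeroʳ : (u : Vec N) → u · (λ _ → + 0) ≡ + 0
·-zeroʳ {N} u = trans (Σᶠ-cong (λ j → *-zeroʳ (u j))) (Σᶠ-zero {N})

δ-· : (i : Fin N) (v : Vec N) → δ i · v ≡ v i
δ-· = Σᶠ-δ

·-δ : (v : Vec N) (i : Fin N) → v · δ i ≡ v i
·-δ v i = trans (·-comm v (δ i)) (δ-· i v)

·-↑ : ∀ p {q} (u w : Vec (p ℕ.+ q)) →
  u · w ≡ (u ∘ (_↑ˡ q)) · (w ∘ (_↑ˡ q)) + (u ∘ (p ↑ʳ_)) · (w ∘ (p ↑ʳ_))
·-↑ p u w = Σᶠ-↑ p (λ j → u j * w j)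

·-++ : (u u' : Vec p) (w w' : Vec q) → (u ++ w) · (u' ++ w') ≡ u · u' + w · w'
·-++ {p} u u' w w' = trans (·-↑ p (u ++ w) (u' ++ w'))
  (cong₂ _+_ (Σᶠ-cong (λ j → cong₂ _*_ (lookup-++ˡ u w j) (lookup-++ˡ u' w' j)))
             (Σᶠ-cong (λ j → cong₂ _*_ (lookup-++ʳ u w j) (lookup-++ʳ u' w' j))))

·-bilinear : (α β γ ε : ℤ) (x y z w : Vec N) →
  (λ j → α * x j + β * y j) · (λ j → γ * z j + ε * w j)
    ≡ α * γ * (x · z) + α * ε * (x · w) + β * γ * (y · z) + β * ε * (y · w)
·-bilinear {zero} α β γ ε x y z w = expand-zero α β γ ε
  where
  expand-zero : ∀ α β γ ε → + 0 ≡ α * γ * + 0 + α * ε * + 0 + β * γ * + 0 + β * ε * + 0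
  expand-zero = solve-∀
·-bilinear {suc N} α β γ ε x y z w =
  trans (cong (_+_ ((α * x zero + β * y zero) * (γ * z zero + ε * w zero)))
              (·-bilinear α β γ ε (x ∘ suc) (y ∘ suc) (z ∘ suc) (w ∘ suc)))
        (expand-suc α β γ ε (x zero) (y zero) (z zero) (w zero) _ _ _ _)
  where
  expand-suc : ∀ α β γ ε x₀ y₀ z₀ w₀ xz xw yz yw →
    (α * x₀ + β * y₀) * (γ * z₀ + ε * w₀) + (α * γ * xz + α * ε * xw + β * γ * yz + β * ε * yw)
      ≡ α * γ * (x₀ * z₀ + xz) + α * ε * (x₀ * w₀ + xw) + β * γ * (y₀ * z₀ + yz) + β * ε * (y₀ * w₀ + yw)
  expand-suc = solve-∀

*ᵥ-· : (x : Vec p) (A : Mat p q) (w : Vec q) → (x *ᵥ A) · w ≡ x · (λ i → A i · w)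
*ᵥ-· x A w = begin
  Σᶠ (λ j → (x *ᵥ A) j * w j)
    ≡⟨ Σᶠ-cong (λ j → trans (*-comm ((x *ᵥ A) j) (w j)) (*-distribˡ-Σᶠ (w j) (λ i → x i * A i j))) ⟩
  Σᶠ (λ j → Σᶠ (λ i → w j * (x i * A i j)))
    ≡⟨ Σᶠ-comm (λ j i → w j * (x i * A i j)) ⟩
  Σᶠ (λ i → Σᶠ (λ j → w j * (x i * A i j)))
    ≡⟨ Σᶠ-cong (λ i → trans (Σᶠ-cong (λ j → regroup (w j) (x i) (A i j)))
                            (sym (*-distribˡ-Σᶠ (x i) (λ j → A i j * w j)))) ⟩
  Σᶠ (λ i → x i * (A i · w))  ∎
  where
  open ≡-Reasoning
  regroup : ∀ a b c → a * (b * c) ≡ b * (c * a)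
  regroup = solve-∀

*ᵥ-I : (x : Vec N) → x *ᵥ I ≗ x
*ᵥ-I x t = trans (·-congʳ x (λ i → δ-sym i t)) (·-δ x t)

*ᵥ-assoc : (x : Vec p) (A : Mat p q) (B : Mat q s) → (x *ᵥ A) *ᵥ B ≗ x *ᵥ (A *ₘ B)
*ᵥ-assoc x A B j = *ᵥ-· x A ((B ᵀ) j)

infix 4 _≈_[mod_]

-- `x ≡ y [mod k ]` unfolds to a statement about `∣ x - y ∣`, from which Agda cannot recover
-- x and y; this record wrapper makes them inferable.
record _≈_[mod_] (x y : ℤ) (k : ℕ) : Set where
  constructor ⟦_⟧
  field ≡-mod : x ≡ y [mod k ]

open _≈_[mod_] public

module _ {k : ℕ} where

  ∣⇒≈ : ∀ {x y} → + k ∣ x - y → x ≈ y [mod k ]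
  ∣⇒≈ k∣x-y = ⟦ ∣⇒∣ᵤ k∣x-y ⟧

  ≈⇒∣ : ∀ {x y} → x ≈ y [mod k ] → + k ∣ x - y
  ≈⇒∣ ⟦ x≡y ⟧ = ∣ᵤ⇒∣ x≡y

  ∣-via : ∀ {z z'} → z ≡ z' → + k ∣ z → + k ∣ z'
  ∣-via = subst (+ k ∣_)

  ≡⇒≈ : ∀ {x y} → x ≡ y → x ≈ y [mod k ]
  ≡⇒≈ {x} refl = ∣⇒≈ (∣-via (trans (*-zeroˡ (+ k)) (sym (+-inverseʳ x))) (divides (+ 0) refl))

  ≈-sym : ∀ {x y} → x ≈ y [mod k ] → y ≈ x [mod k ]
  ≈-sym {x} {y} x≈y = ∣⇒≈ (∣-via (swap x y) (∣m⇒∣-m (≈⇒∣ x≈y)))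
    where
    swap : ∀ x y → - (x - y) ≡ y - x
    swap = solve-∀

  ≈-trans : ∀ {x y z} → x ≈ y [mod k ] → y ≈ z [mod k ] → x ≈ z [mod k ]
  ≈-trans {x} {y} {z} x≈y y≈z = ∣⇒≈ (∣-via (telescope x y z) (∣m∣n⇒∣m+n (≈⇒∣ x≈y) (≈⇒∣ y≈z)))
    where
    telescope : ∀ x y z → (x - y) + (y - z) ≡ x - z
    telescope = solve-∀

  ≈-setoid : Setoid 0ℓ 0ℓ
  ≈-setoid = record
    { Carrier = ℤ
    ; _≈_ = _≈_[mod k ]
    ; isEquivalence = record { refl = ≡⇒≈ refl ; sym = ≈-sym ; trans = ≈-trans }
    }

  +-cong-≈ : ∀ {a b c d} → a ≈ b [mod k ] → c ≈ d [mod k ] → a + c ≈ b + d [mod k ]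
  +-cong-≈ {a} {b} {c} {d} a≈b c≈d = ∣⇒≈ (∣-via (regroup a b c d) (∣m∣n⇒∣m+n (≈⇒∣ a≈b) (≈⇒∣ c≈d)))
    where
    regroup : ∀ a b c d → (a - b) + (c - d) ≡ (a + c) - (b + d)
    regroup = solve-∀

  +-congˡ-≈ : ∀ a {b c} → b ≈ c [mod k ] → a + b ≈ a + c [mod k ]
  +-congˡ-≈ a = +-cong-≈ (≡⇒≈ {a} refl)

  *-cong-≈ : ∀ {a b c d} → a ≈ b [mod k ] → c ≈ d [mod k ] → a * c ≈ b * d [mod k ]
  *-cong-≈ {a} {b} {c} {d} a≈b c≈d =
    ∣⇒≈ (∣-via (regroup a b c d) (∣m∣n⇒∣m+n (∣m⇒∣m*n c (≈⇒∣ a≈b)) (∣n⇒∣m*n b (≈⇒∣ c≈d))))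
    where
    regroup : ∀ a b c d → (a - b) * c + b * (c - d) ≡ a * c - b * d
    regroup = solve-∀

  *-congʳ-≈ : ∀ c {a b} → a ≈ b [mod k ] → a * c ≈ b * c [mod k ]
  *-congʳ-≈ c a≈b = *-cong-≈ a≈b (≡⇒≈ {c} refl)

  -‿cong-≈ : ∀ {a b} → a ≈ b [mod k ] → - a ≈ - b [mod k ]
  -‿cong-≈ {a} {b} a≈b = ∣⇒≈ (∣-via (regroup a b) (∣m⇒∣-m (≈⇒∣ a≈b)))
    where
    regroup : ∀ a b → - (a - b) ≡ - a - - b
    regroup = solve-∀

  +≈0⇒≈- : ∀ {a b} → a + b ≈ + 0 [mod k ] → a ≈ - b [mod k ]
  +≈0⇒≈- {a} {b} a+b≈0 = ∣⇒≈ (∣-via (regroup a b) (≈⇒∣ a+b≈0))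
    where
    regroup : ∀ a b → (a + b) - + 0 ≡ a - - b
    regroup = solve-∀

  Σᶠ-cong-≈ : {f g : Fin N → ℤ} → (∀ i → f i ≈ g i [mod k ]) → Σᶠ f ≈ Σᶠ g [mod k ]
  Σᶠ-cong-≈ {zero} f≈g = ≡⇒≈ refl
  Σᶠ-cong-≈ {suc N} f≈g = +-cong-≈ (f≈g zero) (Σᶠ-cong-≈ (f≈g ∘ suc))

  pointwise-≈ : (u w : Vec N) → (∀ j → u j ≡ w j [mod k ]) → ∀ j → u j ≈ w j [mod k ]
  pointwise-≈ u w u≡w j = ⟦ u≡w j ⟧

  ·-cong-≈ : {u u' w w' : Vec N} →
    (∀ j → u j ≈ u' j [mod k ]) → (∀ j → w j ≈ w' j [mod k ]) → u · w ≈ u' · w' [mod k ]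
  ·-cong-≈ u≈u' w≈w' = Σᶠ-cong-≈ (λ j → *-cong-≈ (u≈u' j) (w≈w' j))

  ·-congʳ-≈ : (u : Vec N) {w w' : Vec N} → (∀ j → w j ≈ w' j [mod k ]) → u · w ≈ u · w' [mod k ]
  ·-congʳ-≈ u w≈w' = ·-cong-≈ {u = u} (λ _ → ≡⇒≈ refl) w≈w'

[I∣_] : Mat n n → Mat n (n ℕ.+ n)
[I∣ N ] i = I i ++ N i

module _ (k : ℕ) where

  open SetoidReasoning (≈-setoid {k})

  spanMod-resp-≗ : {G : Mat p N} {v w : Vec N} → v ≗ w → spanMod k G v → spanMod k G w
  spanMod-resp-≗ {G = G} v≗w (x , v≡xG) =
    x , λ j → subst (λ z → z ≡ (x *ᵥ G) j [mod k ]) (v≗w j) (v≡xG j)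

  row-∈-span : (G : Mat p N) (i : Fin p) → spanMod k G (G i)
  row-∈-span G i = δ i , λ j → ≡-mod (≡⇒≈ (sym (δ-· i (λ s → G s j))))

  span-selfOrthogonal : (G : Mat p N) → (∀ i j → G i · G j ≈ + 0 [mod k ]) →
    ∀ v → spanMod k G v → dual k (spanMod k G) v
  span-selfOrthogonal G G⊥G v (x , v≡xG) w (y , w≡yG) = ≡-mod (begin
    v · w
      ≈⟨ ·-cong-≈ (pointwise-≈ v (x *ᵥ G) v≡xG) (pointwise-≈ w (y *ᵥ G) w≡yG) ⟩
    (x *ᵥ G) · (y *ᵥ G)
      ≡⟨ *ᵥ-· x G (y *ᵥ G) ⟩
    x · (λ i → G i · (y *ᵥ G))
      ≡⟨ ·-congʳ x (λ i → trans (·-comm (G i) (y *ᵥ G)) (*ᵥ-· y G (G i))) ⟩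
    x · (λ i → y · (λ i' → G i' · G i))
      ≈⟨ ·-congʳ-≈ x (λ i → ·-congʳ-≈ y (λ i' → G⊥G i' i)) ⟩
    x · (λ i → y · (λ _ → + 0))
      ≡⟨ ·-congʳ x (λ _ → ·-zeroʳ y) ⟩
    x · (λ _ → + 0)
      ≡⟨ ·-zeroʳ x ⟩
    + 0  ∎)

  ∈-span-[I∣] : (N : Mat n n) (v : Vec (n ℕ.+ n)) →
    (∀ t → v (n ↑ʳ t) ≈ ((v ∘ (_↑ˡ n)) *ᵥ N) t [mod k ]) → spanMod k [I∣ N ] v
  ∈-span-[I∣] {n} N v right = x , splitAt-elim n _ onLeft onRight
    where
    x : Vec n
    x = v ∘ (_↑ˡ n)
    onLeft : ∀ t → v (t ↑ˡ n) ≡ (x *ᵥ [I∣ N ]) (t ↑ˡ n) [mod k ]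
    onLeft t = ≡-mod (≡⇒≈ (sym (trans (·-congʳ x (λ i → lookup-++ˡ (I i) (N i) t)) (*ᵥ-I x t))))
    onRight : ∀ t → v (n ↑ʳ t) ≡ (x *ᵥ [I∣ N ]) (n ↑ʳ t) [mod k ]
    onRight t = ≡-mod (≈-trans (right t) (≡⇒≈ (sym (·-congʳ x (λ i → lookup-++ʳ (I i) (N i) t)))))

  [I∣]-rows-selfOrthogonal : (N : Mat n n) → (∀ i j → (N *ₘ N ᵀ) i j ≈ - I i j [mod k ]) →
    ∀ i j → [I∣ N ] i · [I∣ N ] j ≈ + 0 [mod k ]
  [I∣]-rows-selfOrthogonal N NNᵀ≈-I i j = begin
    [I∣ N ] i · [I∣ N ] j   ≡⟨ ·-++ (I i) (I j) (N i) (N j) ⟩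
    I i · I j + N i · N j   ≡⟨ cong (_+ N i · N j) (trans (δ-· i (I j)) (δ-sym j i)) ⟩
    I i j + (N *ₘ N ᵀ) i j  ≈⟨ +-congˡ-≈ (I i j) (NNᵀ≈-I i j) ⟩
    I i j - I i j           ≡⟨ +-inverseʳ (I i j) ⟩
    + 0                     ∎

  dual⊆span-[I∣] : (N : Mat n n) → (∀ i j → (N ᵀ *ₘ N) i j ≈ - I i j [mod k ]) →
    ∀ v → dual k (spanMod k [I∣ N ]) v → spanMod k [I∣ N ] v
  dual⊆span-[I∣] {n} N NᵀN≈-I v v⊥ = ∈-span-[I∣] N v right
    where
    x y : Vec n
    x = v ∘ (_↑ˡ n)
    y = v ∘ (n ↑ʳ_)
    x≈-yNᵀ : ∀ i → x i ≈ - (y *ᵥ N ᵀ) i [mod k ]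
    x≈-yNᵀ i = +≈0⇒≈- (begin
      x i + y · N i
        ≡⟨ cong₂ _+_ (trans (·-congʳ x (lookup-++ˡ (I i) (N i))) (·-δ x i))
                     (·-congʳ y (lookup-++ʳ (I i) (N i))) ⟨
      x · ([I∣ N ] i ∘ (_↑ˡ n)) + y · ([I∣ N ] i ∘ (n ↑ʳ_))
        ≡⟨ ·-↑ n v ([I∣ N ] i) ⟨
      v · [I∣ N ] i
        ≈⟨ ⟦ v⊥ ([I∣ N ] i) (row-∈-span [I∣ N ] i) ⟧ ⟩
      + 0  ∎)
    right : ∀ t → y t ≈ (x *ᵥ N) t [mod k ]
    right t = ≈-sym (begin
      (x *ᵥ N) t
        ≈⟨ Σᶠ-cong-≈ (λ i → *-congʳ-≈ (N i t) (x≈-yNᵀ i)) ⟩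
      Σᶠ (λ i → - (y *ᵥ N ᵀ) i * N i t)
        ≡⟨ Σᶠ-cong (λ i → neg-distribˡ-* ((y *ᵥ N ᵀ) i) (N i t)) ⟨
      Σᶠ (λ i → - ((y *ᵥ N ᵀ) i * N i t))
        ≡⟨ Σᶠ-neg (λ i → (y *ᵥ N ᵀ) i * N i t) ⟩
      - ((y *ᵥ N ᵀ) *ᵥ N) t
        ≡⟨ cong -_ (*ᵥ-assoc y (N ᵀ) N t) ⟩
      - (y *ᵥ (N ᵀ *ₘ N)) t
        ≈⟨ -‿cong-≈ (·-congʳ-≈ y (λ s → NᵀN≈-I s t)) ⟩
      - Σᶠ (λ s → y s * - I s t)
        ≡⟨ cong -_ (trans (Σᶠ-cong (λ s → sym (neg-distribʳ-* (y s) (I s t)))) (Σᶠ-neg (λ s → y s * I s t))) ⟩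
      - - (y *ᵥ I) t
        ≡⟨ trans (neg-involutive _) (*ᵥ-I y t) ⟩
      y t  ∎)

  [I∣]-selfDual : (N : Mat n n) →
    (∀ i j → (N *ₘ N ᵀ) i j ≈ - I i j [mod k ]) → (∀ i j → (N ᵀ *ₘ N) i j ≈ - I i j [mod k ]) →
    SelfDual k (spanMod k [I∣ N ])
  [I∣]-selfDual N NNᵀ≈-I NᵀN≈-I v =
    span-selfOrthogonal [I∣ N ] ([I∣]-rows-selfOrthogonal N NNᵀ≈-I) v , dual⊆span-[I∣] N NᵀN≈-I v

module AntisymmetricPencils {n : ℕ} (M : Mat n n) (m : ℤ)
  (antisym : ∀ i j → M j i ≡ - M i j) (MMᵀ≡mI : ∀ i j → (M *ₘ M ᵀ) i j ≡ m * I i j) where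

  pencil-gram : ∀ α β γ ε (i j : Fin n) →
    (aI+bA α β M *ₘ aI+bA γ ε M ᵀ) i j ≡ (α * γ + β * ε * m) * I i j + (β * γ - α * ε) * M i j
  pencil-gram α β γ ε i j = begin
    (λ t → α * I i t + β * M i t) · (λ t → γ * I j t + ε * M j t)
      ≡⟨ ·-bilinear α β γ ε (I i) (M i) (I j) (M j) ⟩
    α * γ * (I i · I j) + α * ε * (I i · M j) + β * γ * (M i · I j) + β * ε * (M i · M j)
      ≡⟨ cong₂ _+_ (cong₂ _+_ (cong₂ _+_ (cong (α * γ *_) (trans (δ-· i (I j)) (δ-sym j i)))
                                         (cong (α * ε *_) (trans (δ-· i (M j)) (antisym i j))))
                              (cong (β * γ *_) (·-δ (M i) j)))
                   (cong (β * ε *_) (MMᵀ≡mI i j)) ⟩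
    α * γ * I i j + α * ε * - M i j + β * γ * M i j + β * ε * (m * I i j)
      ≡⟨ collect α β γ ε m (I i j) (M i j) ⟩
    (α * γ + β * ε * m) * I i j + (β * γ - α * ε) * M i j  ∎
    where
    open ≡-Reasoning
    collect : ∀ α β γ ε m e x →
      α * γ * e + α * ε * - x + β * γ * x + β * ε * (m * e) ≡ (α * γ + β * ε * m) * e + (β * γ - α * ε) * x
    collect = solve-∀

  blockRow : ℤ → ℤ → ℤ → ℤ → Fin n → Vec (n ℕ.+ n)
  blockRow α β γ ε i = aI+bA α β M i ++ aI+bA γ ε M i

  blockRow-· : ∀ α β γ ε α' β' γ' ε' (i j : Fin n) →
    blockRow α β γ ε i · blockRow α' β' γ' ε' j
      ≡ (α * α' + β * β' * m + (γ * γ' + ε * ε' * m)) * I i j + (β * α' - α * β' + (ε * γ' - γ * ε')) * M i j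
  blockRow-· α β γ ε α' β' γ' ε' i j = begin
    blockRow α β γ ε i · blockRow α' β' γ' ε' j
      ≡⟨ ·-++ (aI+bA α β M i) (aI+bA α' β' M j) (aI+bA γ ε M i) (aI+bA γ' ε' M j) ⟩
    (aI+bA α β M *ₘ aI+bA α' β' M ᵀ) i j + (aI+bA γ ε M *ₘ aI+bA γ' ε' M ᵀ) i j
      ≡⟨ cong₂ _+_ (pencil-gram α β α' β' i j) (pencil-gram γ ε γ' ε' i j) ⟩
    (α * α' + β * β' * m) * I i j + (β * α' - α * β') * M i j
      + ((γ * γ' + ε * ε' * m) * I i j + (ε * γ' - γ * ε') * M i j)
      ≡⟨ collect (α * α' + β * β' * m) (β * α' - α * β') (γ * γ' + ε * ε' * m) (ε * γ' - γ * ε') (I i j) (M i j) ⟩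
    (α * α' + β * β' * m + (γ * γ' + ε * ε' * m)) * I i j + (β * α' - α * β' + (ε * γ' - γ * ε')) * M i j  ∎
    where
    open ≡-Reasoning
    collect : ∀ p q r s e x → p * e + q * x + (r * e + s * x) ≡ (p + r) * e + (q + s) * x
    collect = solve-∀

  module _ (a b c d : ℤ) where

    private
      F : Mat (n ℕ.+ n) (n ℕ.+ n)
      F = Fmat M a b c d

    Fmat-norm : ℤ
    Fmat-norm = a * a + m * (b * b) + c * c + m * (d * d)

    Fmat-↑ˡ : ∀ i → F (i ↑ˡ n) ≗ blockRow a b c d i
    Fmat-↑ˡ i = cong-app (lookup-++ˡ _ _ i)

    Fmat-↑ʳ : ∀ i → F (n ↑ʳ i) ≗ blockRow (- c) d a (- b) i
    Fmat-↑ʳ i j = trans (cong-app (lookup-++ʳ {m = n} _ _ i) j)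
      (++-cong _ _ (λ t → neg-first c d (I i t) (M i t)) (λ t → minus-second a b (I i t) (M i t)) j)
      where
      neg-first : ∀ c d e x → - (c * e) + d * x ≡ - c * e + d * x
      neg-first = solve-∀
      minus-second : ∀ a b e x → a * e - b * x ≡ a * e + - b * x
      minus-second = solve-∀

    Fmat-↑ˡ·↑ˡ : ∀ i j → F (i ↑ˡ n) · F (j ↑ˡ n) ≡ Fmat-norm * δ (i ↑ˡ n) (j ↑ˡ n)
    Fmat-↑ˡ·↑ˡ i j = begin
      F (i ↑ˡ n) · F (j ↑ˡ n)                  ≡⟨ ·-cong (Fmat-↑ˡ i) (Fmat-↑ˡ j) ⟩
      blockRow a b c d i · blockRow a b c d j  ≡⟨ blockRow-· a b c d a b c d i j ⟩
      _                                        ≡⟨ collect a b c d m (I i j) (M i j) ⟩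
      Fmat-norm * I i j
        ≡⟨ cong (Fmat-norm *_) (δ-injective (_↑ˡ n) (↑ˡ-injective n _ _) i j) ⟨
      Fmat-norm * δ (i ↑ˡ n) (j ↑ˡ n)          ∎
      where
      open ≡-Reasoning
      collect : ∀ a b c d m e x →
        (a * a + b * b * m + (c * c + d * d * m)) * e + (b * a - a * b + (d * c - c * d)) * x
          ≡ (a * a + m * (b * b) + c * c + m * (d * d)) * e
      collect = solve-∀

    Fmat-↑ʳ·↑ʳ : ∀ i j → F (n ↑ʳ i) · F (n ↑ʳ j) ≡ Fmat-norm * δ (n ↑ʳ i) (n ↑ʳ j)
    Fmat-↑ʳ·↑ʳ i j = begin
      F (n ↑ʳ i) · F (n ↑ʳ j)                                  ≡⟨ ·-cong (Fmat-↑ʳ i) (Fmat-↑ʳ j) ⟩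
      blockRow (- c) d a (- b) i · blockRow (- c) d a (- b) j  ≡⟨ blockRow-· (- c) d a (- b) (- c) d a (- b) i j ⟩
      _                                                        ≡⟨ collect a b c d m (I i j) (M i j) ⟩
      Fmat-norm * I i j
        ≡⟨ cong (Fmat-norm *_) (δ-injective (n ↑ʳ_) (↑ʳ-injective n _ _) i j) ⟨
      Fmat-norm * δ (n ↑ʳ i) (n ↑ʳ j)                          ∎
      where
      open ≡-Reasoning
      collect : ∀ a b c d m e x →
        (- c * - c + d * d * m + (a * a + - b * - b * m)) * e + (d * - c - - c * d + (- b * a - a * - b)) * x
          ≡ (a * a + m * (b * b) + c * c + m * (d * d)) * e
      collect = solve-∀

    Fmat-↑ˡ·↑ʳ : ∀ i j → F (i ↑ˡ n) · F (n ↑ʳ j) ≡ Fmat-norm * δ (i ↑ˡ n) (n ↑ʳ j)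
    Fmat-↑ˡ·↑ʳ i j = begin
      F (i ↑ˡ n) · F (n ↑ʳ j)                          ≡⟨ ·-cong (Fmat-↑ˡ i) (Fmat-↑ʳ j) ⟩
      blockRow a b c d i · blockRow (- c) d a (- b) j  ≡⟨ blockRow-· a b c d (- c) d a (- b) i j ⟩
      _                                                ≡⟨ collect a b c d m Fmat-norm (I i j) (M i j) ⟩
      Fmat-norm * + 0                                  ≡⟨ cong (Fmat-norm *_) (δ-≢ (↑ˡ≢↑ʳ i j)) ⟨
      Fmat-norm * δ (i ↑ˡ n) (n ↑ʳ j)                  ∎
      where
      open ≡-Reasoning
      collect : ∀ a b c d m S e x →
        (a * - c + b * d * m + (c * a + d * - b * m)) * e + (b * - c - a * d + (d * a - c * - b)) * x ≡ S * + 0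
      collect = solve-∀

    Fmat-↑ʳ·↑ˡ : ∀ i j → F (n ↑ʳ i) · F (j ↑ˡ n) ≡ Fmat-norm * δ (n ↑ʳ i) (j ↑ˡ n)
    Fmat-↑ʳ·↑ˡ i j = begin
      F (n ↑ʳ i) · F (j ↑ˡ n)                          ≡⟨ ·-cong (Fmat-↑ʳ i) (Fmat-↑ˡ j) ⟩
      blockRow (- c) d a (- b) i · blockRow a b c d j  ≡⟨ blockRow-· (- c) d a (- b) a b c d i j ⟩
      _                                                ≡⟨ collect a b c d m Fmat-norm (I i j) (M i j) ⟩
      Fmat-norm * + 0                                  ≡⟨ cong (Fmat-norm *_) (δ-≢ (↑ˡ≢↑ʳ j i ∘ sym)) ⟨
      Fmat-norm * δ (n ↑ʳ i) (j ↑ˡ n)                  ∎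
      where
      open ≡-Reasoning
      collect : ∀ a b c d m S e x →
        (- c * a + d * b * m + (a * c + - b * d * m)) * e + (d * a - - c * b + (- b * c - a * d)) * x ≡ S * + 0
      collect = solve-∀

    Fmat-rows-orthogonal : ∀ x y → F x · F y ≡ Fmat-norm * δ x y
    Fmat-rows-orthogonal = splitAt-elim n _
      (λ i → splitAt-elim n _ (Fmat-↑ˡ·↑ˡ i) (Fmat-↑ˡ·↑ʳ i))
      (λ i → splitAt-elim n _ (Fmat-↑ʳ·↑ˡ i) (Fmat-↑ʳ·↑ʳ i))

  module _ (ℓ : ℤ) where

    M+ℓI : Mat n n
    M+ℓI i j = M i j + ℓ * I i j

    M+ℓI≗pencil : ∀ i → M+ℓI i ≗ aI+bA ℓ (+ 1) M i
    M+ℓI≗pencil i j = swap (M i j) (I i j) ℓ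
      where
      swap : ∀ x e ℓ → x + ℓ * e ≡ ℓ * e + + 1 * x
      swap = solve-∀

    M+ℓIᵀ≗pencil : ∀ i → (M+ℓI ᵀ) i ≗ aI+bA ℓ (- + 1) M i
    M+ℓIᵀ≗pencil i j = trans (cong₂ (λ x e → x + ℓ * e) (antisym i j) (δ-sym j i)) (swap (M i j) (I i j) ℓ)
      where
      swap : ∀ x e ℓ → - x + ℓ * e ≡ ℓ * e + - + 1 * x
      swap = solve-∀

    M+ℓI-gram : ∀ i j → (M+ℓI *ₘ M+ℓI ᵀ) i j ≡ (m + ℓ * ℓ) * I i j
    M+ℓI-gram i j = begin
      M+ℓI i · M+ℓI j
        ≡⟨ ·-cong (M+ℓI≗pencil i) (M+ℓI≗pencil j) ⟩
      (aI+bA ℓ (+ 1) M *ₘ aI+bA ℓ (+ 1) M ᵀ) i j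
        ≡⟨ pencil-gram ℓ (+ 1) ℓ (+ 1) i j ⟩
      (ℓ * ℓ + + 1 * + 1 * m) * I i j + (+ 1 * ℓ - ℓ * + 1) * M i j
        ≡⟨ collect ℓ m (I i j) (M i j) ⟩
      (m + ℓ * ℓ) * I i j  ∎
      where
      open ≡-Reasoning
      collect : ∀ ℓ m e x → (ℓ * ℓ + + 1 * + 1 * m) * e + (+ 1 * ℓ - ℓ * + 1) * x ≡ (m + ℓ * ℓ) * e
      collect = solve-∀

    M+ℓI-cogram : ∀ i j → (M+ℓI ᵀ *ₘ M+ℓI) i j ≡ (m + ℓ * ℓ) * I i j
    M+ℓI-cogram i j = begin
      (M+ℓI ᵀ) i · (M+ℓI ᵀ) j
        ≡⟨ ·-cong (M+ℓIᵀ≗pencil i) (M+ℓIᵀ≗pencil j) ⟩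
      (aI+bA ℓ (- + 1) M *ₘ aI+bA ℓ (- + 1) M ᵀ) i j
        ≡⟨ pencil-gram ℓ (- + 1) ℓ (- + 1) i j ⟩
      (ℓ * ℓ + - + 1 * - + 1 * m) * I i j + (- + 1 * ℓ - ℓ * - + 1) * M i j
        ≡⟨ collect ℓ m (I i j) (M i j) ⟩
      (m + ℓ * ℓ) * I i j  ∎
      where
      open ≡-Reasoning
      collect : ∀ ℓ m e x → (ℓ * ℓ + - + 1 * - + 1 * m) * e + (- + 1 * ℓ - ℓ * - + 1) * x ≡ (m + ℓ * ℓ) * e
      collect = solve-∀

    pencil-*ᵥ-M+ℓI : ∀ α β i t →
      ((aI+bA α β M) i *ᵥ M+ℓI) t ≡ (α * ℓ - β * m) * I i t + (α + ℓ * β) * M i t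
    pencil-*ᵥ-M+ℓI α β i t = begin
      aI+bA α β M i · (M+ℓI ᵀ) t
        ≡⟨ ·-congʳ (aI+bA α β M i) (M+ℓIᵀ≗pencil t) ⟩
      (aI+bA α β M *ₘ aI+bA ℓ (- + 1) M ᵀ) i t
        ≡⟨ pencil-gram α β ℓ (- + 1) i t ⟩
      (α * ℓ + β * - + 1 * m) * I i t + (β * ℓ - α * - + 1) * M i t
        ≡⟨ collect α β ℓ m (I i t) (M i t) ⟩
      (α * ℓ - β * m) * I i t + (α + ℓ * β) * M i t  ∎
      where
      open ≡-Reasoning
      collect : ∀ α β ℓ m e x →
        (α * ℓ + β * - + 1 * m) * e + (β * ℓ - α * - + 1) * x ≡ (α * ℓ - β * m) * e + (α + ℓ * β) * x
      collect = solve-∀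

    module _ (k : ℕ) (m+ℓ²≈-1 : m + ℓ * ℓ ≈ - + 1 [mod k ]) where

      scaled-I≈-I : {A : Mat n n} → (∀ i j → A i j ≡ (m + ℓ * ℓ) * I i j) → ∀ i j → A i j ≈ - I i j [mod k ]
      scaled-I≈-I A≡ i j =
        ≈-trans (≡⇒≈ (A≡ i j)) (≈-trans (*-congʳ-≈ (I i j) m+ℓ²≈-1) (≡⇒≈ (-1*i≡-i (I i j))))

      [I∣M+ℓI]-selfDual : SelfDual k (spanMod k [I∣ M+ℓI ])
      [I∣M+ℓI]-selfDual = [I∣]-selfDual k M+ℓI (scaled-I≈-I M+ℓI-gram) (scaled-I≈-I M+ℓI-cogram)

      blockRow-∈ : ∀ α β γ ε i → γ ≈ α * ℓ - β * m [mod k ] → ε ≈ α + ℓ * β [mod k ] →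
        spanMod k [I∣ M+ℓI ] (blockRow α β γ ε i)
      blockRow-∈ α β γ ε i γ≈ ε≈ = ∈-span-[I∣] k M+ℓI (blockRow α β γ ε i) right
        where
        open SetoidReasoning (≈-setoid {k})
        right : ∀ t → blockRow α β γ ε i (n ↑ʳ t) ≈ ((blockRow α β γ ε i ∘ (_↑ˡ n)) *ᵥ M+ℓI) t [mod k ]
        right t = begin
          blockRow α β γ ε i (n ↑ʳ t)
            ≡⟨ lookup-++ʳ (aI+bA α β M i) (aI+bA γ ε M i) t ⟩
          γ * I i t + ε * M i t
            ≈⟨ +-cong-≈ (*-congʳ-≈ (I i t) γ≈) (*-congʳ-≈ (M i t) ε≈) ⟩
          (α * ℓ - β * m) * I i t + (α + ℓ * β) * M i t
            ≡⟨ pencil-*ᵥ-M+ℓI α β i t ⟨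
          (aI+bA α β M i *ᵥ M+ℓI) t
            ≡⟨ Σᶠ-cong (λ s → cong (_* M+ℓI s t) (lookup-++ˡ (aI+bA α β M i) (aI+bA γ ε M i) s)) ⟨
          ((blockRow α β γ ε i ∘ (_↑ˡ n)) *ᵥ M+ℓI) t  ∎

      module _ (a b c d : ℤ) (b≈c-ℓd : b ≈ c - ℓ * d [mod k ]) (d≈a+ℓb : d ≈ a + ℓ * b [mod k ]) where

        private
          k∣E : + k ∣ (m + ℓ * ℓ) - - + 1
          k∣E = ≈⇒∣ m+ℓ²≈-1
          k∣B : + k ∣ b - (c - ℓ * d)
          k∣B = ≈⇒∣ b≈c-ℓd
          k∣D : + k ∣ d - (a + ℓ * b)
          k∣D = ≈⇒∣ d≈a+ℓb

        Fmat-norm-divisible : + k ∣ Fmat-norm a b c d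
        Fmat-norm-divisible = ∣-via (expand a b c d m ℓ)
          (∣m∣n⇒∣m-n (∣m∣n⇒∣m-n (∣m⇒∣m*n (b * b + d * d) k∣E) (∣m⇒∣m*n (b + ℓ * d + c) k∣B))
                     (∣m⇒∣m*n (a + d - ℓ * b) k∣D))
          where
          expand : ∀ a b c d m ℓ →
            ((m + ℓ * ℓ) - - + 1) * (b * b + d * d) - (b - (c - ℓ * d)) * (b + ℓ * d + c)
              - (d - (a + ℓ * b)) * (a + d - ℓ * b)
              ≡ a * a + m * (b * b) + c * c + m * (d * d)
          expand = solve-∀

        Fmat-rows-∈ : ∀ x → spanMod k [I∣ M+ℓI ] (Fmat M a b c d x)
        Fmat-rows-∈ = splitAt-elim n _
          (λ i → spanMod-resp-≗ k (sym ∘ Fmat-↑ˡ a b c d i) (blockRow-∈ a b c d i c≈ d≈a+ℓb))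
          (λ i → spanMod-resp-≗ k (sym ∘ Fmat-↑ʳ a b c d i) (blockRow-∈ (- c) d a (- b) i a≈ -b≈))
          where
          c≈ : c ≈ a * ℓ - b * m [mod k ]
          c≈ = ∣⇒≈ (∣-via (expand a b c d m ℓ)
            (∣m∣n⇒∣m+n (∣m∣n⇒∣m-n (∣n⇒∣m*n b k∣E) k∣B) (∣n⇒∣m*n ℓ k∣D)))
            where
            expand : ∀ a b c d m ℓ →
              b * ((m + ℓ * ℓ) - - + 1) - (b - (c - ℓ * d)) + ℓ * (d - (a + ℓ * b)) ≡ c - (a * ℓ - b * m)
            expand = solve-∀
          a≈ : a ≈ - c * ℓ - d * m [mod k ]
          a≈ = ∣⇒≈ (∣-via (expand a b c d m ℓ)
            (∣m∣n⇒∣m-n (∣m∣n⇒∣m-n (∣n⇒∣m*n d k∣E) k∣D) (∣n⇒∣m*n ℓ k∣B)))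
            where
            expand : ∀ a b c d m ℓ →
              d * ((m + ℓ * ℓ) - - + 1) - (d - (a + ℓ * b)) - ℓ * (b - (c - ℓ * d)) ≡ a - (- c * ℓ - d * m)
            expand = solve-∀
          -b≈ : - b ≈ - c + ℓ * d [mod k ]
          -b≈ = ∣⇒≈ (∣-via (expand b c d ℓ) (∣m⇒∣-m k∣B))
            where
            expand : ∀ b c d ℓ → - (b - (c - ℓ * d)) ≡ - b - (- c + ℓ * d)
            expand = solve-∀

        Fmat-frame : Σ ℤ λ r → (+ k * r ≡ Fmat-norm a b c d)
                             × IsFrameAk k (spanMod k [I∣ M+ℓI ]) r (Fmat M a b c d)
        Fmat-frame = r , k*r≡norm , Fmat-rows-∈ , λ x y →
          trans (Fmat-rows-orthogonal a b c d x y) (cong (_* δ x y) (sym k*r≡norm))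
          where
          r : ℤ
          r = _∣_.quotient Fmat-norm-divisible
          k*r≡norm : + k * r ≡ Fmat-norm a b c d
          k*r≡norm = trans (*-comm (+ k) r) (sym (_∣_.equality Fmat-norm-divisible))

proposition4p1 : (k : ℕ) → 2 ≤ k → (ℓ : ℕ) → ℓ < k →
    (n : ℕ) (M : Mat n n) (m : ℤ) →
    (∀ i j → M j i ≡ - M i j) →
    (∀ i j → Σᶠ (λ t → M i t * M j t) ≡ m * I i j) →
    (m + (+ ℓ) * (+ ℓ)) ≡ - (+ 1) [mod k ] →
    SelfDual k (C2nk k M (+ ℓ))
    × (∀ (a b c d : ℤ) → b ≡ c - (+ ℓ) * d [mod k ] → d ≡ a + (+ ℓ) * b [mod k ] →
        Σ ℤ λ r → ((+ k) * r ≡ a * a + m * (b * b) + c * c + m * (d * d))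
          × IsFrameAk k (C2nk k M (+ ℓ)) r (Fmat M a b c d))
proposition4p1 k _ ℓ _ n M m antisym MMᵀ≡mI m+ℓ²≡-1 =
  [I∣M+ℓI]-selfDual (+ ℓ) k ⟦ m+ℓ²≡-1 ⟧ ,
  λ a b c d b≡c-ℓd d≡a+ℓb → Fmat-frame (+ ℓ) k ⟦ m+ℓ²≡-1 ⟧ a b c d ⟦ b≡c-ℓd ⟧ ⟦ d≡a+ℓb ⟧
  where open AntisymmetricPencils M m antisym MMᵀ≡mI
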